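{- For each integer $k\ge 1$ and each integer $r\ge 1$, if $G$ is a connected $r$-regular claw-free graph of order $n$, then there exists a connected $r'$-regular claw-free graph $G'$ of order $n'=(k+1)n$ such that $r'=kr+r+k$ and $\gamma_{p,k}(G')=\gamma(G)$.
   Context: All graphs are finite and simple. A graph is claw-free if it has no induced subgraph isomorphic to $K_{1,3}$. $N_G[v]$ is the closed neighborhood of $v$ and $N_G[S]=\bigcup_{v\in S}N_G[v]$. For an integer $k\ge 0$ and $S\subseteq V(G)$, define $P^0_G(S)=N_G[S]$ and $P^{i+1}_G(S)=\bigcup\{N_G[v]: v\in P^i_G(S) \text{ and } |N_G[v]\setminus P^i_G(S)|\le k\}$; these stabilize at $P^\infty_G(S)$. $S$ is a $k$-power dominating set if $P^\infty_G(S)=V(G)$, and $\gamma_{p,k}(G)$ is the minimum cardinality of such a set. A dominating set of $G$ is a set $S$ such that every vertex not in $S$ is adjacent to a vertex of $S$; $\gamma(G)$ is the minimum cardinality of a dominating set. -}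

module Defs where

open import Data.Nat using (ℕ; zero; suc; _≤_; _≤ᵇ_)
open import Data.Bool using (Bool; true; false; _∧_; _∨_; not)
open import Data.Fin using (Fin; _≟_)
open import Data.Fin.Subset using (Subset; _∈_; _∉_; ∣_∣; _─_; ⊤)
open import Data.Vec using (tabulate)
open import Data.List using (allFin)
open import Data.Bool.ListAction using (any)
open import Data.Product using (Σ; ∃; ∃-syntax; _×_)
open import Data.Sum using (_⊎_)
open import Relation.Binary.PropositionalEquality using (_≡_; _≢_)
open import Relation.Nullary using (¬_)
open import Relation.Nullary.Decidable using (⌊_⌋)

record Graph (n : ℕ) : Set where
  field
    adj     : Fin n → Fin n → Bool
    adj-sym : ∀ u v → adj u v ≡ adj v u
    irrefl  : ∀ v → adj v v ≡ false
open Graph public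

Adj : ∀ {n} → Graph n → Fin n → Fin n → Set
Adj G u v = adj G u v ≡ true

anyFin : ∀ {n} → (Fin n → Bool) → Bool
anyFin {n} p = any p (allFin n)

degree : ∀ {n} → Graph n → Fin n → ℕ
degree G v = ∣ tabulate (adj G v) ∣

Regular : ∀ {n} → Graph n → ℕ → Set
Regular G r = ∀ v → degree G v ≡ r

data Reach {n} (G : Graph n) : Fin n → Fin n → Set where
  here : ∀ {v} → Reach G v v
  step : ∀ {u w v} → Adj G u w → Reach G w v → Reach G u v

Connected : ∀ {n} → Graph n → Set
Connected G = ∀ u v → Reach G u v

ClawFree : ∀ {n} → Graph n → Set
ClawFree G = ∀ c a b d →
  ¬ ( Adj G c a × Adj G c b × Adj G c d
    × a ≢ b × a ≢ d × b ≢ d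
    × adj G a b ≡ false × adj G a d ≡ false × adj G b d ≡ false )

N[_∣_] : ∀ {n} → Graph n → Fin n → Subset n
N[ G ∣ v ] = tabulate (λ w → ⌊ v ≟ w ⌋ ∨ adj G v w)

NS : ∀ {n} → Graph n → Subset n → Subset n
NS {n} G S = tabulate (λ w → anyFin (λ u → Data.Vec.lookup S u ∧ Data.Vec.lookup N[ G ∣ u ] w))

propStep : ∀ {n} → ℕ → Graph n → Subset n → Subset n
propStep k G P = tabulate (λ w → anyFin (λ v →
  Data.Vec.lookup P v ∧ (∣ N[ G ∣ v ] ─ P ∣ ≤ᵇ k) ∧ Data.Vec.lookup N[ G ∣ v ] w))

P^ : ∀ {n} → ℕ → Graph n → Subset n → ℕ → Subset n
P^ k G S zero    = NS G S
P^ k G S (suc i) = propStep k G (P^ k G S i)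

-- S is k-power dominating iff P^∞(S) = V, i.e. P^i(S) = V for some i
-- (the sequence P^i is increasing, so this is P^∞(S) = V).
KPowerDominating : ∀ {n} → ℕ → Graph n → Subset n → Set
KPowerDominating k G S = ∃[ i ] (P^ k G S i ≡ ⊤)

Dominating : ∀ {n} → Graph n → Subset n → Set
Dominating G S = ∀ v → v ∈ S ⊎ (∃[ u ] (u ∈ S × Adj G u v))

IsMinCard : ∀ {n} → (Subset n → Set) → ℕ → Set
IsMinCard Prop m = (∃[ S ] (Prop S × ∣ S ∣ ≡ m)) × (∀ S → Prop S → m ≤ ∣ S ∣)

IsDominationNumber : ∀ {n} → Graph n → ℕ → Set
IsDominationNumber G = IsMinCard (Dominating G)

IsKPowerDominationNumber : ∀ {n} → ℕ → Graph n → ℕ → Set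
IsKPowerDominationNumber k G = IsMinCard (KPowerDominating k G)

-- Given G on n vertices and c : ℕ, the blow-up G ⊠ K_(c+1) replaces every vertex u
-- of G by the c+1 vertices (i , u), and joins two distinct vertices (i , u), (j , v)
-- iff u = v or u ~ v.  So the closed neighbourhood of (i , u) is exactly the preimage
-- of N_G[u]; connectedness, claw-freeness and regularity (degree (c+1)(r+1) - 1)
-- transfer from G directly.
--
-- Every closed neighbourhood in the blow-up is a union of fibres, hence so is N[S]
-- and everything obtained from it by a propagation step.  If a vertex v of such a
-- set P has a neighbour w outside P, the whole fibre of w (c+1 vertices) lies in
-- N[v] \ P, so for k ≤ c propagation never fires and P^∞(S) = N[S].  Thus a k-power
-- dominating set S dominates the blow-up, and its projection dominates G and is no
-- larger than S; conversely one copy of a dominating set of G is k-power dominating.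
-- Taking c = k and D a minimum dominating set (which exists since domination is
-- decidable on finite sets) gives γ_{p,k}(G ⊠ K_(k+1)) = γ(G).

module Submission where

open import Defs
open import Data.Nat using (ℕ; zero; suc; _+_; _*_; _≤_; _≤ᵇ_; z≤n; s≤s; _≤?_)
open import Data.Nat.Properties
  using (≤-refl; ≤-trans; ≤-reflexive; +-mono-≤; +-monoʳ-≤; m≤n+m; +-assoc; +-comm;
         +-identityʳ; *-zeroʳ; +-cancelʳ-≡; ≤ᵇ⇒≤; <⇒≱; ≰⇒>; n≤0⇒n≡0)
open import Data.Nat.Solver using (module +-*-Solver)
open import Data.Bool using (Bool; true; false; _∧_; _∨_; not; T)
open import Data.Bool.Properties using (T-≡; ⇔→≡)
import Data.Bool as Bool
open import Data.Bool.ListAction using (or)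
open import Data.Fin using (Fin; zero; suc; _≟_; combine; remQuot; _↑ˡ_; _↑ʳ_)
open import Data.Fin.Properties
  using (remQuot-combine; combine-remQuot; combine-injectiveˡ; combine-injectiveʳ; any?; all?)
open import Data.Fin.Subset using (Subset; _∈_; ∣_∣; _─_; ⊤)
open import Data.Fin.Subset.Properties using (anySubset?; _∈?_; ∈⊤; ⊆⊤; ⊆-antisym)
open import Data.Vec using (tabulate; lookup; _∷_)
open import Data.Vec.Properties using (lookup∘tabulate; tabulate∘lookup; []=⇒lookup; lookup⇒[]=)
open import Data.List using (allFin)
open import Data.List.Properties using (map-tabulate)
open import Data.List.Membership.Propositional using (lose)
open import Data.List.Membership.Propositional.Properties using (∈-allFin)
open import Data.List.Relation.Unary.Any using (satisfied)
open import Data.List.Relation.Unary.Any.Properties using (any⁺; any⁻)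
open import Data.Product using (Σ; ∃-syntax; _×_; _,_; proj₁; proj₂)
open import Data.Sum using (_⊎_; inj₁; inj₂)
open import Function using (_∘_; id)
open import Function.Bundles using (Equivalence; mk⇔)
open import Relation.Nullary using (yes; no; contradiction)
open import Relation.Nullary.Decidable using (⌊_⌋; _×-dec_; _⊎-dec_; ⌊⌋-map′)
open import Relation.Unary using (Decidable)
open import Relation.Binary.PropositionalEquality
  using (_≡_; _≢_; refl; sym; trans; cong; cong₂; subst; subst₂; module ≡-Reasoning)

open Equivalence using (to; from)

∧-true : ∀ a b → a ∧ b ≡ true → a ≡ true × b ≡ true
∧-true true true _ = refl , refl

≟-refl : ∀ {n} (x : Fin n) → ⌊ x ≟ x ⌋ ≡ true
≟-refl x with x ≟ x
... | yes _ = refl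
... | no x≢x = contradiction refl x≢x

≟-sym : ∀ {n} (x y : Fin n) → ⌊ x ≟ y ⌋ ≡ ⌊ y ≟ x ⌋
≟-sym x y with x ≟ y | y ≟ x
... | yes _ | yes _ = refl
... | yes x≡y | no y≢x = contradiction (sym x≡y) y≢x
... | no x≢y | yes y≡x = contradiction (sym y≡x) x≢y
... | no _ | no _ = refl

indicator : Bool → ℕ
indicator true = 1
indicator false = 0

count : ∀ {n} → (Fin n → Bool) → ℕ
count {zero} f = 0
count {suc n} f = indicator (f zero) + count (λ i → f (suc i))

sumFin : ∀ {m} → (Fin m → ℕ) → ℕ
sumFin {zero} h = 0
sumFin {suc m} h = h zero + sumFin (λ i → h (suc i))

card-tabulate : ∀ {n} (f : Fin n → Bool) → ∣ tabulate f ∣ ≡ count f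
card-tabulate {zero} f = refl
card-tabulate {suc n} f with f zero
... | true = cong suc (card-tabulate (λ i → f (suc i)))
... | false = card-tabulate (λ i → f (suc i))

card-count : ∀ {n} (S : Subset n) → ∣ S ∣ ≡ count (lookup S)
card-count S = trans (cong ∣_∣ (sym (tabulate∘lookup S))) (card-tabulate (lookup S))

count-cong : ∀ {n} {f g : Fin n → Bool} → (∀ i → f i ≡ g i) → count f ≡ count g
count-cong {zero} e = refl
count-cong {suc n} e = cong₂ _+_ (cong indicator (e zero)) (count-cong (λ i → e (suc i)))

sumFin-cong : ∀ {m} {h h′ : Fin m → ℕ} → (∀ i → h i ≡ h′ i) → sumFin h ≡ sumFin h′
sumFin-cong {zero} e = refl
sumFin-cong {suc m} e = cong₂ _+_ (e zero) (sumFin-cong (λ i → e (suc i)))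

sumFin-const : ∀ m c → sumFin {m} (λ _ → c) ≡ m * c
sumFin-const zero c = refl
sumFin-const (suc m) c = cong (c +_) (sumFin-const m c)

count-false : ∀ {n} → count {n} (λ _ → false) ≡ 0
count-false {zero} = refl
count-false {suc n} = count-false {n}

count-↑ : ∀ a b (f : Fin (a + b) → Bool) →
  count f ≡ count (λ i → f (i ↑ˡ b)) + count (λ i → f (a ↑ʳ i))
count-↑ zero b f = refl
count-↑ (suc a) b f =
  trans (cong (indicator (f zero) +_) (count-↑ a b (λ i → f (suc i))))
        (sym (+-assoc (indicator (f zero)) _ _))

count-combine : ∀ m n (f : Fin (m * n) → Bool) →
  count f ≡ sumFin {m} (λ i → count (λ v → f (combine i v)))
count-combine zero n f = refl
count-combine (suc m) n f =
  trans (count-↑ n (m * n) f)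
        (cong (count (λ v → f (v ↑ˡ (m * n))) +_) (count-combine m n (λ x → f (n ↑ʳ x))))

count-remove : ∀ {n} (f : Fin n → Bool) x →
  count (λ y → not ⌊ x ≟ y ⌋ ∧ f y) + indicator (f x) ≡ count f
count-remove f zero = +-comm (count (λ i → f (suc i))) (indicator (f zero))
count-remove {suc n} f (suc x) = begin
  indicator (f zero) + count (λ y → not ⌊ suc x ≟ suc y ⌋ ∧ f (suc y)) + indicator (f (suc x))
    ≡⟨ +-assoc (indicator (f zero)) _ _ ⟩
  indicator (f zero) + (count (λ y → not ⌊ suc x ≟ suc y ⌋ ∧ f (suc y)) + indicator (f (suc x)))
    ≡⟨ cong (λ m → indicator (f zero) + (m + indicator (f (suc x))))
            (count-cong (λ y → cong (λ b → not b ∧ f (suc y)) (⌊⌋-map′ _ _ (x ≟ y)))) ⟩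
  indicator (f zero) + (count (λ y → not ⌊ x ≟ y ⌋ ∧ f (suc y)) + indicator (f (suc x)))
    ≡⟨ cong (indicator (f zero) +_) (count-remove (λ i → f (suc i)) x) ⟩
  indicator (f zero) + count (λ i → f (suc i)) ∎
  where open ≡-Reasoning

count-∨ : ∀ {n} (f g : Fin n → Bool) → count (λ v → f v ∨ g v) ≤ count f + count g
count-∨ {zero} f g = z≤n
count-∨ {suc n} f g = ≤-trans
  (+-mono-≤ (indicator-∨ (f zero) (g zero)) (count-∨ (λ i → f (suc i)) (λ i → g (suc i))))
  (≤-reflexive (interchange (indicator (f zero)) (indicator (g zero)) _ _))
  where
  indicator-∨ : ∀ a b → indicator (a ∨ b) ≤ indicator a + indicator b
  indicator-∨ true b = s≤s z≤n
  indicator-∨ false b = ≤-refl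
  interchange : ∀ a b c d → (a + b) + (c + d) ≡ (a + c) + (b + d)
  interchange = +-*-Solver.solve 4 (λ a b c d → (a :+ b) :+ (c :+ d) := (a :+ c) :+ (b :+ d)) refl
    where open +-*-Solver

count-positive : ∀ {n} (f : Fin n → Bool) x → f x ≡ true → 1 ≤ count f
count-positive f zero fx rewrite fx = s≤s z≤n
count-positive f (suc x) fx =
  ≤-trans (count-positive (λ i → f (suc i)) x fx) (m≤n+m _ (indicator (f zero)))

sumFin-positive : ∀ m (h : Fin m → ℕ) → (∀ i → 1 ≤ h i) → m ≤ sumFin h
sumFin-positive zero h pos = z≤n
sumFin-positive (suc m) h pos =
  +-mono-≤ (pos zero) (sumFin-positive m (λ i → h (suc i)) (λ i → pos (suc i)))

∈─ : ∀ {m} (i : Fin m) (p q : Subset m) → lookup p i ≡ true → lookup q i ≡ false →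
  lookup (p ─ q) i ≡ true
∈─ zero (true ∷ p) (false ∷ q) refl refl = refl
∈─ (suc i) (_ ∷ p) (_ ∷ q) pi qi = ∈─ i p q pi qi

all∈⇒⊤ : ∀ {n} (P : Subset n) → (∀ x → lookup P x ≡ true) → P ≡ ⊤
all∈⇒⊤ P all = ⊆-antisym ⊆⊤ (λ {x} _ → lookup⇒[]= x P (all x))

anyFin-intro : ∀ {n} (p : Fin n → Bool) i → p i ≡ true → anyFin p ≡ true
anyFin-intro p i pi = to T-≡ (any⁺ p (lose {P = T ∘ p} (∈-allFin i) (from T-≡ pi)))

anyFin-elim : ∀ {n} (p : Fin n → Bool) → anyFin p ≡ true → ∃[ i ] (p i ≡ true)
anyFin-elim {n} p e with satisfied (any⁻ p (allFin n) (from T-≡ e))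
... | i , pi = i , to T-≡ pi

anyFin-cong : ∀ {n} {p q : Fin n → Bool} → (∀ i → p i ≡ q i) → anyFin p ≡ anyFin q
anyFin-cong {p = p} {q} e = ⇔→≡ (mk⇔ (transfer p q e) (transfer q p (λ i → sym (e i))))
  where
  transfer : ∀ p q → (∀ i → p i ≡ q i) → anyFin p ≡ true → anyFin q ≡ true
  transfer p q e h with anyFin-elim p h
  ... | i , pi = anyFin-intro q i (trans (sym (e i)) pi)

anyFin-suc : ∀ {m} (p : Fin (suc m) → Bool) → anyFin p ≡ p zero ∨ anyFin (λ i → p (suc i))
anyFin-suc p = cong (p zero ∨_)
  (cong or (trans (map-tabulate suc p) (sym (map-tabulate id (λ i → p (suc i))))))

count-anyFin : ∀ m {n} (g : Fin m → Fin n → Bool) →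
  count (λ v → anyFin (λ i → g i v)) ≤ sumFin (λ i → count (g i))
count-anyFin zero {n} g = ≤-reflexive (count-false {n})
count-anyFin (suc m) g = begin
  count (λ v → anyFin (λ i → g i v))
    ≡⟨ count-cong (λ v → anyFin-suc (λ i → g i v)) ⟩
  count (λ v → g zero v ∨ anyFin (λ i → g (suc i) v))
    ≤⟨ count-∨ (g zero) _ ⟩
  count (g zero) + count (λ v → anyFin (λ i → g (suc i) v))
    ≤⟨ +-monoʳ-≤ (count (g zero)) (count-anyFin m (λ i → g (suc i))) ⟩
  count (g zero) + sumFin (λ i → count (g (suc i))) ∎
  where open Data.Nat.Properties.≤-Reasoning

minimumCardinality : ∀ {n} (P : Subset n → Set) → Decidable P → ∀ S → P S → ∃[ m ] IsMinCard P m
minimumCardinality P P? S pS = search ∣ S ∣ S pS ≤-refl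
  where
  -- search b S: S witnesses P with ∣ S ∣ ≤ b; look for a witness of size < b first.
  search : ∀ b S → P S → ∣ S ∣ ≤ b → ∃[ m ] IsMinCard P m
  search zero S pS ∣S∣≤0 = 0 , (S , pS , n≤0⇒n≡0 ∣S∣≤0) , (λ _ _ → z≤n)
  search (suc b) S pS ∣S∣≤b with anySubset? (λ T → P? T ×-dec (∣ T ∣ ≤? b))
  ... | yes (T , pT , ∣T∣≤b) = search b T pT ∣T∣≤b
  ... | no none = ∣ S ∣ , (S , pS , refl) , minimal
    where
    minimal : ∀ T → P T → ∣ S ∣ ≤ ∣ T ∣
    minimal T pT with ∣ T ∣ ≤? b
    ... | yes ∣T∣≤b = contradiction (T , pT , ∣T∣≤b) none
    ... | no ∣T∣≰b = ≤-trans ∣S∣≤b (≰⇒> ∣T∣≰b)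

dominating? : ∀ {n} (G : Graph n) → Decidable (Dominating G)
dominating? G S = all? (λ v → (v ∈? S) ⊎-dec any? (λ u → (u ∈? S) ×-dec (adj G u v Bool.≟ true)))

module Blowup {n : ℕ} (c : ℕ) (G : Graph n) where

  near : Fin n → Fin n → Bool
  near u v = ⌊ u ≟ v ⌋ ∨ adj G u v

  near-refl : ∀ u → near u u ≡ true
  near-refl u rewrite ≟-refl u = refl

  near-sym : ∀ u v → near u v ≡ near v u
  near-sym u v = cong₂ _∨_ (≟-sym u v) (adj-sym G u v)

  near-adj : ∀ {u v} → Adj G u v → near u v ≡ true
  near-adj {u} {v} uv rewrite uv with ⌊ u ≟ v ⌋
  ... | true = refl
  ... | false = refl

  near⇒ : ∀ {u v} → near u v ≡ true → u ≡ v ⊎ Adj G u v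
  near⇒ {u} {v} e with u ≟ v
  ... | yes u≡v = inj₁ u≡v
  ... | no _ = inj₂ e

  near-false : ∀ {u v} → near u v ≡ false → u ≢ v × adj G u v ≡ false
  near-false {u} {v} e with u ≟ v
  ... | no u≢v = u≢v , e

  adj-distinct : ∀ {u v} → Adj G u v → u ≢ v
  adj-distinct {u} uv refl = contradiction (trans (sym uv) (irrefl G u)) (λ ())

  centre-adj : ∀ {u v w} → near u v ≡ true → near u w ≡ true → near v w ≡ false → Adj G u v
  centre-adj uv uw vw with near⇒ uv
  ... | inj₂ u~v = u~v
  ... | inj₁ refl = contradiction (trans (sym uw) vw) (λ ())

  -- Vertices of the blow-up: (i , u) is  vertex i u ; base and layer invert it.
  V : ℕ
  V = suc c * n

  vertex : Fin (suc c) → Fin n → Fin V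
  vertex = combine

  base : Fin V → Fin n
  base x = proj₂ (remQuot {suc c} n x)

  layer : Fin V → Fin (suc c)
  layer x = proj₁ (remQuot {suc c} n x)

  base-vertex : ∀ i u → base (vertex i u) ≡ u
  base-vertex i u = cong proj₂ (remQuot-combine {suc c} {n} i u)

  layer-vertex : ∀ i u → layer (vertex i u) ≡ i
  layer-vertex i u = cong proj₁ (remQuot-combine {suc c} {n} i u)

  vertex-layer-base : ∀ x → vertex (layer x) (base x) ≡ x
  vertex-layer-base x = combine-remQuot {suc c} n x

  near-vertex : ∀ i j u v → near (base (vertex i u)) (base (vertex j v)) ≡ near u v
  near-vertex i j u v = cong₂ near (base-vertex i u) (base-vertex j v)

  adj′ : Fin V → Fin V → Bool
  adj′ x y = not ⌊ x ≟ y ⌋ ∧ near (base x) (base y)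

  blowup : Graph V
  blowup = record
    { adj = adj′
    ; adj-sym = λ x y → cong₂ (λ a b → not a ∧ b) (≟-sym x y) (near-sym (base x) (base y))
    ; irrefl = λ x → cong (λ a → not a ∧ near (base x) (base x)) (≟-refl x)
    }

  adj′-intro : ∀ {x y} → x ≢ y → near (base x) (base y) ≡ true → Adj blowup x y
  adj′-intro {x} {y} x≢y e with x ≟ y
  ... | yes x≡y = contradiction x≡y x≢y
  ... | no _ = e

  adj′-elim : ∀ {x y} → Adj blowup x y → near (base x) (base y) ≡ true
  adj′-elim {x} {y} e with x ≟ y
  ... | no _ = e

  adj′-false : ∀ {x y} → x ≢ y → adj′ x y ≡ false → near (base x) (base y) ≡ false
  adj′-false {x} {y} x≢y e with x ≟ y
  ... | yes x≡y = contradiction x≡y x≢y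
  ... | no _ = e

  closedNbhd : ∀ x y → lookup N[ blowup ∣ x ] y ≡ near (base x) (base y)
  closedNbhd x y rewrite lookup∘tabulate (λ w → ⌊ x ≟ w ⌋ ∨ adj′ x w) y with x ≟ y
  ... | yes refl = sym (near-refl (base x))
  ... | no _ = refl

  closedNbhd-vertex : ∀ x i v → lookup N[ blowup ∣ x ] (vertex i v) ≡ near (base x) v
  closedNbhd-vertex x i v = trans (closedNbhd x (vertex i v)) (cong (near (base x)) (base-vertex i v))

  lift-walk : ∀ {u v} → Reach G u v → ∀ i j → Reach blowup (vertex i u) (vertex j v)
  lift-walk {u} here i j with i ≟ j
  ... | yes refl = here
  ... | no i≢j = step (adj′-intro (i≢j ∘ combine-injectiveˡ i u j u)
                                  (trans (near-vertex i j u u) (near-refl u))) here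
  lift-walk {u} (step {w = w} u~w walk) i j =
    step (adj′-intro (adj-distinct u~w ∘ combine-injectiveʳ i u i w)
                     (trans (near-vertex i i u w) (near-adj u~w)))
         (lift-walk walk i j)

  blowup-connected : Connected G → Connected blowup
  blowup-connected conn x y = subst₂ (Reach blowup) (vertex-layer-base x) (vertex-layer-base y)
    (lift-walk (conn (base x) (base y)) (layer x) (layer y))

  count-near : ∀ {r} → Regular G r → ∀ u → count (near u) ≡ r + 1
  count-near {r} reg u = begin
    count (near u)                                          ≡⟨ sym (count-remove (near u) u) ⟩
    count (λ y → not ⌊ u ≟ y ⌋ ∧ near u y) + indicator (near u u)
      ≡⟨ cong₂ _+_ (count-cong open-nbhd) (cong indicator (near-refl u)) ⟩
    count (adj G u) + 1                                     ≡⟨ cong (_+ 1) (sym (card-tabulate (adj G u))) ⟩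
    degree G u + 1                                          ≡⟨ cong (_+ 1) (reg u) ⟩
    r + 1 ∎
    where
    open ≡-Reasoning
    open-nbhd : ∀ y → (not ⌊ u ≟ y ⌋ ∧ near u y) ≡ adj G u y
    open-nbhd y with u ≟ y
    ... | yes refl = sym (irrefl G u)
    ... | no _ = refl

  -- Each vertex sees c+1 copies of its closed neighbourhood, itself excluded.
  blowup-regular : ∀ r → Regular G r → Regular blowup (c * r + r + c)
  blowup-regular r reg x = +-cancelʳ-≡ 1 _ _ (begin
    degree blowup x + 1
      ≡⟨ cong₂ _+_ (card-tabulate (adj′ x)) (cong indicator (sym (near-refl (base x)))) ⟩
    count (adj′ x) + indicator (near (base x) (base x))
      ≡⟨ count-remove (λ y → near (base x) (base y)) x ⟩
    count (λ y → near (base x) (base y))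
      ≡⟨ count-combine (suc c) n _ ⟩
    sumFin (λ i → count (λ v → near (base x) (base (vertex i v))))
      ≡⟨ sumFin-cong (λ i → trans (count-cong (λ v → cong (near (base x)) (base-vertex i v)))
                                  (count-near reg (base x))) ⟩
    sumFin {suc c} (λ _ → r + 1)
      ≡⟨ sumFin-const (suc c) (r + 1) ⟩
    suc c * (r + 1)
      ≡⟨ +-*-Solver.solve 2 (λ c r → (con 1 :+ c) :* (r :+ con 1) := (c :* r :+ r :+ c) :+ con 1)
                             refl c r ⟩
    c * r + r + c + 1 ∎)
    where
    open ≡-Reasoning
    open +-*-Solver using (con; _:+_; _:*_; _:=_)

  -- A claw in the blow-up projects to a claw in G.
  blowup-clawFree : ClawFree G → ClawFree blowup
  blowup-clawFree cf x a b d (xa , xb , xd , a≢b , a≢d , b≢d , ab , ad , bd) =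
    cf (base x) (base a) (base b) (base d)
      ( centre-adj xa′ xb′ ab′
      , centre-adj xb′ xa′ (trans (near-sym _ _) ab′)
      , centre-adj xd′ xa′ (trans (near-sym _ _) ad′)
      , proj₁ (near-false ab′) , proj₁ (near-false ad′) , proj₁ (near-false bd′)
      , proj₂ (near-false ab′) , proj₂ (near-false ad′) , proj₂ (near-false bd′) )
    where
    xa′ : near (base x) (base a) ≡ true
    xa′ = adj′-elim xa
    xb′ : near (base x) (base b) ≡ true
    xb′ = adj′-elim xb
    xd′ : near (base x) (base d) ≡ true
    xd′ = adj′-elim xd
    ab′ : near (base a) (base b) ≡ false
    ab′ = adj′-false a≢b ab
    ad′ : near (base a) (base d) ≡ false
    ad′ = adj′-false a≢d ad
    bd′ : near (base b) (base d) ≡ false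
    bd′ = adj′-false b≢d bd

  FibreClosed : Subset V → Set
  FibreClosed P = ∀ x y → base x ≡ base y → lookup P x ≡ lookup P y

  -- Any union of closed neighbourhoods is fibre-closed; N[S] and propagation steps are such unions.
  nbhdUnion-fibreClosed : (F : Fin V → Bool → Bool) →
    FibreClosed (tabulate (λ w → anyFin (λ v → F v (lookup N[ blowup ∣ v ] w))))
  nbhdUnion-fibreClosed F x y bx≡by = begin
    lookup (tabulate _) x                             ≡⟨ lookup∘tabulate _ x ⟩
    anyFin (λ v → F v (lookup N[ blowup ∣ v ] x))
      ≡⟨ anyFin-cong (λ v → cong (F v) (begin
           lookup N[ blowup ∣ v ] x   ≡⟨ closedNbhd v x ⟩
           near (base v) (base x)     ≡⟨ cong (near (base v)) bx≡by ⟩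
           near (base v) (base y)     ≡⟨ sym (closedNbhd v y) ⟩
           lookup N[ blowup ∣ v ] y   ∎)) ⟩
    anyFin (λ v → F v (lookup N[ blowup ∣ v ] y))     ≡⟨ sym (lookup∘tabulate _ y) ⟩
    lookup (tabulate _) y ∎
    where open ≡-Reasoning

  -- If w ∈ N[v] \ P with P fibre-closed, the whole fibre of w lies in N[v] \ P.
  fibre-escapes : ∀ P v w → FibreClosed P → lookup N[ blowup ∣ v ] w ≡ true →
    lookup P w ≡ false → suc c ≤ ∣ N[ blowup ∣ v ] ─ P ∣
  fibre-escapes P v w closed vw Pw = begin
    suc c
      ≤⟨ sumFin-positive (suc c) _
           (λ i → count-positive (λ u → lookup D (vertex i u)) (base w) (copy-escapes i)) ⟩
    sumFin (λ i → count (λ u → lookup D (vertex i u)))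
      ≡⟨ sym (trans (card-count D) (count-combine (suc c) n (lookup D))) ⟩
    ∣ D ∣ ∎
    where
    open Data.Nat.Properties.≤-Reasoning
    D : Subset V
    D = N[ blowup ∣ v ] ─ P
    copy-escapes : ∀ i → lookup D (vertex i (base w)) ≡ true
    copy-escapes i = ∈─ (vertex i (base w)) N[ blowup ∣ v ] P
      (trans (closedNbhd-vertex v i (base w)) (trans (sym (closedNbhd v w)) vw))
      (trans (closed _ _ (base-vertex i (base w))) Pw)

  module _ (k : ℕ) (k≤c : k ≤ c) where

    propagation-stalls : ∀ P → FibreClosed P → ∀ w →
      lookup (propStep k blowup P) w ≡ true → lookup P w ≡ true
    propagation-stalls P closed w e
      with anyFin-elim (λ v → lookup P v ∧ ((∣ N[ blowup ∣ v ] ─ P ∣ ≤ᵇ k) ∧ lookup N[ blowup ∣ v ] w))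
                       (trans (sym (lookup∘tabulate _ w)) e)
    ... | v , fires with ∧-true _ _ (proj₂ (∧-true (lookup P v) _ fires))
    ... | small , vw with lookup P w in Pw
    ... | true = refl
    ... | false = contradiction (≤ᵇ⇒≤ _ k (from T-≡ small))
                                (<⇒≱ (≤-trans (s≤s k≤c) (fibre-escapes P v w closed vw Pw)))

    iterate-fibreClosed : ∀ S i → FibreClosed (P^ k blowup S i)
    iterate-fibreClosed S zero = nbhdUnion-fibreClosed (λ u b → lookup S u ∧ b)
    iterate-fibreClosed S (suc i) = nbhdUnion-fibreClosed
      (λ v b → lookup (P^ k blowup S i) v ∧ ((∣ N[ blowup ∣ v ] ─ P^ k blowup S i ∣ ≤ᵇ k) ∧ b))

    iterate⊆closedNbhd : ∀ S i w → lookup (P^ k blowup S i) w ≡ true → lookup (NS blowup S) w ≡ true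
    iterate⊆closedNbhd S zero w e = e
    iterate⊆closedNbhd S (suc i) w e = iterate⊆closedNbhd S i w
      (propagation-stalls (P^ k blowup S i) (iterate-fibreClosed S i) w e)

    kpd⇒covers : ∀ S → KPowerDominating k blowup S → ∀ w → lookup (NS blowup S) w ≡ true
    kpd⇒covers S (i , Pi≡⊤) w = iterate⊆closedNbhd S i w
      ([]=⇒lookup (subst (w ∈_) (sym Pi≡⊤) ∈⊤))

  project : Subset V → Subset n
  project S = tabulate (λ v → anyFin (λ i → lookup S (vertex i v)))

  ∈project : ∀ S x → lookup S x ≡ true → base x ∈ project S
  ∈project S x Sx = lookup⇒[]= (base x) (project S) (trans (lookup∘tabulate _ (base x))
    (anyFin-intro _ (layer x) (trans (cong (lookup S) (vertex-layer-base x)) Sx)))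

  ∣project∣≤ : ∀ S → ∣ project S ∣ ≤ ∣ S ∣
  ∣project∣≤ S = begin
    ∣ project S ∣                                        ≡⟨ card-tabulate {n} _ ⟩
    count (λ v → anyFin (λ i → lookup S (vertex i v)))
      ≤⟨ count-anyFin (suc c) (λ i v → lookup S (vertex i v)) ⟩
    sumFin (λ i → count (λ v → lookup S (vertex i v)))  ≡⟨ sym (count-combine (suc c) n (lookup S)) ⟩
    count (lookup S)                                     ≡⟨ sym (card-count S) ⟩
    ∣ S ∣ ∎
    where open Data.Nat.Properties.≤-Reasoning

  covers⇒projectDominating : ∀ S → (∀ w → lookup (NS blowup S) w ≡ true) → Dominating G (project S)
  covers⇒projectDominating S covers v
    with anyFin-elim _ (trans (sym (lookup∘tabulate _ (vertex zero v))) (covers (vertex zero v)))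
  ... | u , hit with ∧-true (lookup S u) _ hit
  ... | Su , uw with near⇒ (trans (sym (closedNbhd-vertex u zero v)) uw)
  ... | inj₁ refl = inj₁ (∈project S u Su)
  ... | inj₂ u~v = inj₂ (base u , ∈project S u Su , u~v)

  layer0 : Subset n → Subset V
  layer0 D = tabulate (λ x → ⌊ layer x ≟ zero ⌋ ∧ lookup D (base x))

  ∣layer0∣ : ∀ D → ∣ layer0 D ∣ ≡ ∣ D ∣
  ∣layer0∣ D = begin
    ∣ layer0 D ∣
      ≡⟨ card-tabulate {V} _ ⟩
    count (λ x → ⌊ layer x ≟ zero ⌋ ∧ lookup D (base x))
      ≡⟨ count-combine (suc c) n _ ⟩
    sumFin (λ i → count (λ v → ⌊ layer (vertex i v) ≟ zero ⌋ ∧ lookup D (base (vertex i v))))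
      ≡⟨ sumFin-cong (λ i → count-cong (λ v →
           cong₂ (λ j u → ⌊ j ≟ zero ⌋ ∧ lookup D u) (layer-vertex i v) (base-vertex i v))) ⟩
    count (lookup D) + sumFin {c} (λ _ → count {n} (λ _ → false))
      ≡⟨ cong (count (lookup D) +_) (trans (sumFin-cong {c} (λ _ → count-false {n}))
                                          (trans (sumFin-const c 0) (*-zeroʳ c))) ⟩
    count (lookup D) + 0
      ≡⟨ trans (+-identityʳ _) (sym (card-count D)) ⟩
    ∣ D ∣ ∎
    where open ≡-Reasoning

  -- The layer-0 copy of a dominating set of G already covers the blow-up by N[·],
  -- so it is k-power dominating for every k.
  layer0-kpd : ∀ k D → Dominating G D → KPowerDominating k blowup (layer0 D)
  layer0-kpd k D dom = 0 , all∈⇒⊤ _ covered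
    where
    ∈layer0 : ∀ u → u ∈ D → lookup (layer0 D) (vertex zero u) ≡ true
    ∈layer0 u u∈D = trans (lookup∘tabulate _ (vertex zero u))
      (trans (cong₂ (λ j v → ⌊ j ≟ zero ⌋ ∧ lookup D v) (layer-vertex zero u) (base-vertex zero u))
             ([]=⇒lookup u∈D))
    covers : ∀ w u → u ∈ D → near u (base w) ≡ true → lookup (NS blowup (layer0 D)) w ≡ true
    covers w u u∈D uw = trans (lookup∘tabulate _ w) (anyFin-intro _ (vertex zero u)
      (cong₂ _∧_ (∈layer0 u u∈D)
                 (trans (closedNbhd (vertex zero u) w)
                        (trans (cong (λ z → near z (base w)) (base-vertex zero u)) uw))))
    covered : ∀ w → lookup (NS blowup (layer0 D)) w ≡ true
    covered w with dom (base w)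
    ... | inj₁ bw∈D = covers w (base w) bw∈D (near-refl (base w))
    ... | inj₂ (u , u∈D , u~bw) = covers w u u∈D (near-adj u~bw)

-- The blow-up G ⊠ K_(k+1) realises γ_{p,k} = γ(G): a minimum dominating set of G,
-- copied into layer 0, is k-power dominating, and every k-power dominating set
-- projects onto a dominating set of G.
mainTheorem5 : (k r n : ℕ) → 1 ≤ k → 1 ≤ r → (G : Graph n) →
    Connected G → Regular G r → ClawFree G →
    Σ (Graph (suc k * n)) λ G' → (Connected G' × Regular G' (k * r + r + k) × ClawFree G'
    × ∃[ m ] (IsKPowerDominationNumber k G' m × IsDominationNumber G m))
mainTheorem5 k r n _ _ G conn reg cf
  with minimumCardinality (Dominating G) (dominating? G) ⊤ (λ _ → inj₁ ∈⊤)
... | γ , minimum@((D , D-dom , ∣D∣≡γ) , D-min) =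
  blowup , blowup-connected conn , blowup-regular r reg , blowup-clawFree cf ,
  γ , ((layer0 D , layer0-kpd k D D-dom , trans (∣layer0∣ D) ∣D∣≡γ) , lower-bound) , minimum
  where
  open Blowup k G
  lower-bound : ∀ S → KPowerDominating k blowup S → γ ≤ ∣ S ∣
  lower-bound S S-kpd = ≤-trans
    (D-min (project S) (covers⇒projectDominating S (kpd⇒covers k ≤-refl S S-kpd)))
    (∣project∣≤ S)
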